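{- Let $\mathcal{S}=(S,\leq,\circ)$ be a $(\leq,\circ)$-structure belonging to $R(\sqsubseteq,;)$ and let $\theta$ be a representation of $\mathcal{S}$ (so $a\mapsto a^\theta$ is injective, $(a\circ b)^\theta=a^\theta;b^\theta$, and $a\leq b\iff a^\theta\sqsubseteq b^\theta$). Then for all $a,b,s\in S$: \begin{align*} a\blacktriangleleft b &\Rightarrow \mathrm{dom}(a^\theta)\subseteq \mathrm{dom}(b^\theta),\\ a\triangleleft^s b &\Rightarrow a^\theta\restriction_{\mathrm{dom}(s^\theta)}\subseteq b^\theta. \end{align*}
   Context: For binary relations $R,S$ on a set $X$: $R;S=\{(x,y):\exists z\,((x,z)\in R\wedge(z,y)\in S)\}$; $\mathrm{dom}(S)=\{x:\exists y\,(x,y)\in S\}$; $R\restriction_{Y}=\{(x,y)\in R: x\in Y\}$; demonic refinement is $R\sqsubseteq S\iff(\mathrm{dom}(S)\subseteq\mathrm{dom}(R)\wedge R\restriction_{\mathrm{dom}(S)}\subseteq S)$. A $(\leq,\circ)$-structure is a set with a binary relation $\leq$ and a binary operation $\circ$. $R(\sqsubseteq,;)$ is the class of $(\leq,\circ)$-structures isomorphic to a set of binary relations on some base set, closed under $;$, with $\leq$ interpreted as $\sqsubseteq$ and $\circ$ as $;$; such an isomorphism is a representation. In a $(\leq,\circ)$-structure, define for $n<\omega$ predicates $\blacktriangleleft_n$ (binary) and $\triangleleft^s_n$ (binary, indexed by an element $s$) recursively: $a\blacktriangleleft_0 b\iff a\geq b\ \vee\ \exists c\,(a\geq b\circ c)$;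 $a\triangleleft^s_0 b\iff (a\leq b\wedge s=b)$; $a\blacktriangleleft_{n+1}b\iff a\triangleleft^a_n b\ \vee\ \exists c\,(a\blacktriangleleft_n c\wedge c\blacktriangleleft_n b)\ \vee\ \exists d,f,f'\,(a=d\circ f\wedge f\blacktriangleleft_n f'\wedge b=d\circ f')$; $a\triangleleft^s_{n+1}b\iff \exists c\,(a\triangleleft^s_n c\wedge c\triangleleft^s_n b)\ \vee\ \exists c,c',d,d'\,(a=c\circ d\wedge c\triangleleft^s_n c'\wedge d\triangleleft^d_n d'\wedge b=c'\circ d')\ \vee\ \exists s'\,(a\triangleleft^{s'}_n b\wedge s\blacktriangleleft_n s')$. Then $a\blacktriangleleft b$ iff $a\blacktriangleleft_n b$ for some $n<\omega$, and $a\triangleleft^s b$ iff $a\triangleleft^s_n b$ for some $n<\omega$. -}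

module Defs where

open import Level using (Level; _⊔_; suc)
open import Data.Nat using (ℕ; zero; suc)
open import Data.Product using (Σ; ∃; _×_; _,_)
open import Data.Sum using (_⊎_)
open import Relation.Binary.PropositionalEquality using (_≡_)
open import Function.Bundles using (_⇔_)

record LCStructure (a ℓ : Level) : Set (Level.suc (a ⊔ ℓ)) where
  field
    Carrier : Set a
    _≤_     : Carrier → Carrier → Set ℓ
    _∘_     : Carrier → Carrier → Carrier

BRel : ∀ {x} (X : Set x) (r : Level) → Set (x ⊔ Level.suc r)
BRel X r = X → X → Set r

module _ {x r : Level} {X : Set x} where

  _⨾_ : BRel X r → BRel X r → BRel X (x ⊔ r)
  (R ⨾ S) u v = ∃ λ z → R u z × S z v

  dom : BRel X r → X → Set (x ⊔ r)
  dom R u = ∃ λ v → R u v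

  -- restriction R↾Y ⊆ S, i.e. ∀ (x,y) ∈ R with x ∈ Y, (x,y) ∈ S
  RestrictSubset : ∀ {y} → BRel X r → (X → Set y) → BRel X r → Set (x ⊔ r ⊔ y)
  RestrictSubset R Y S = ∀ u v → Y u → R u v → S u v

  _⊆ₚ_ : (X → Set (x ⊔ r)) → (X → Set (x ⊔ r)) → Set (x ⊔ r)
  P ⊆ₚ Q = ∀ u → P u → Q u

  _⊑_ : BRel X r → BRel X r → Set (x ⊔ r)
  R ⊑ S = (dom S ⊆ₚ dom R) × RestrictSubset R (dom S) S

  _≐_ : BRel X r → BRel X r → Set (x ⊔ r)
  R ≐ S = ∀ u v → (R u v ⇔ S u v)

record Representation {a ℓ : Level} (𝒮 : LCStructure a ℓ)
                      {x : Level} (X : Set x) (r : Level)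
                      : Set (a ⊔ ℓ ⊔ Level.suc (x ⊔ r)) where
  open LCStructure 𝒮
  field
    θ        : Carrier → BRel X (x ⊔ r)
    injective : ∀ p q → θ p ≐ θ q → p ≡ q
    hom-∘    : ∀ p q → θ (p ∘ q) ≐ (θ p ⨾ θ q)
    hom-≤    : ∀ p q → (p ≤ q) ⇔ (θ p ⊑ θ q)

module Triangles {a ℓ : Level} (𝒮 : LCStructure a ℓ) where
  open LCStructure 𝒮

  _≥_ : Carrier → Carrier → Set ℓ
  p ≥ q = q ≤ p

  ◀_ : ℕ → Carrier → Carrier → Set (a ⊔ ℓ)
  ◁_ : ℕ → Carrier → Carrier → Carrier → Set (a ⊔ ℓ)   -- ◁ n s p q  means  p ◁ˢₙ q

  (◀ zero) p q = Level.Lift a (p ≥ q) ⊎ (∃ λ c → p ≥ (q ∘ c))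
  (◀ suc n) p q =
      (◁ n) p p q
    ⊎ (∃ λ c → (◀ n) p c × (◀ n) c q)
    ⊎ (∃ λ d → ∃ λ f → ∃ λ f' → (p ≡ d ∘ f) × (◀ n) f f' × (q ≡ d ∘ f'))

  (◁ zero) s p q = Level.Lift a (p ≤ q) × (s ≡ q)
  (◁ suc n) s p q =
      (∃ λ c → (◁ n) s p c × (◁ n) s c q)
    ⊎ (∃ λ c → ∃ λ c' → ∃ λ d → ∃ λ d' →
         (p ≡ c ∘ d) × (◁ n) s c c' × (◁ n) d d d' × (q ≡ c' ∘ d'))
    ⊎ (∃ λ s' → (◁ n) s' p q × (◀ n) s s')

  _◀_ : Carrier → Carrier → Set (a ⊔ ℓ)
  p ◀ q = ∃ λ n → (◀ n) p q

  _◁[_]_ : Carrier → Carrier → Carrier → Set (a ⊔ ℓ)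
  p ◁[ s ] q = ∃ λ n → (◁ n) s p q

-- The relational facts
-- behind the clauses are: refinement a ⊑ b shrinks the domain from a to b and
-- makes a agree with b on dom b; composition is monotone in both arguments for
-- inclusion of relations and of domains; and in the mixed clause
-- s ◀ s' ∧ a ◁^{s'} b, the inclusion dom s ⊆ dom s' lets the restriction to
-- dom s' be weakened to dom s.
module Submission where

open import Defs
open import Level using (Level)
open import Data.Product using (_×_; _,_; proj₁; proj₂)
open import Data.Nat using (zero; suc)
open import Data.Sum using (inj₁; inj₂)
open import Relation.Binary.PropositionalEquality using (refl)
open import Function.Bundles using (Equivalence)

module Relations {x r : Level} {X : Set x} where

  dom-⨾ˡ : ∀ (R S : BRel X r) u → dom (R ⨾ S) u → dom R u
  dom-⨾ˡ R S u (v , z , Ruz , _) = z , Ruz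

  dom-⨾-monoʳ : ∀ (R S S′ : BRel X r) → (∀ z → dom S z → dom S′ z) →
                ∀ u → dom (R ⨾ S) u → dom (R ⨾ S′) u
  dom-⨾-monoʳ R S S′ S⊆S′ u (v , z , Ruz , Szv) with S⊆S′ z (v , Szv)
  ... | w , S′zw = w , z , Ruz , S′zw

  restrict-trans : ∀ {y} {Y : X → Set y} (R S T : BRel X r) →
                   RestrictSubset R Y S → RestrictSubset S Y T → RestrictSubset R Y T
  restrict-trans R S T R⊆S S⊆T u v Yu Ruv = S⊆T u v Yu (R⊆S u v Yu Ruv)

  restrict-antitone : ∀ {y} {Y Y′ : X → Set y} (R S : BRel X r) →
                      (∀ u → Y′ u → Y u) → RestrictSubset R Y S → RestrictSubset R Y′ S
  restrict-antitone R S Y′⊆Y R⊆S u v Y′u = R⊆S u v (Y′⊆Y u Y′u)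

  restrict-⨾ : ∀ {y} {Y : X → Set y} (R R′ S S′ : BRel X r) →
               RestrictSubset R Y R′ → RestrictSubset S (dom S) S′ →
               RestrictSubset (R ⨾ S) Y (R′ ⨾ S′)
  restrict-⨾ R R′ S S′ R⊆R′ S⊆S′ u v Yu (z , Ruz , Szv) =
    z , R⊆R′ u z Yu Ruz , S⊆S′ z v (v , Szv) Szv

module Soundness {a ℓ x r : Level} (𝒮 : LCStructure a ℓ) {X : Set x}
                 (ρ : Representation 𝒮 X r) where
  open LCStructure 𝒮
  open Representation ρ
  open Triangles 𝒮
  open Equivalence
  open Relations

  ≤⇒dom⊇ : ∀ p q → p ≤ q → ∀ u → dom (θ q) u → dom (θ p) u
  ≤⇒dom⊇ p q p≤q = proj₁ (to (hom-≤ p q) p≤q)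

  ≤⇒restrict⊆ : ∀ p q → p ≤ q → RestrictSubset (θ p) (dom (θ q)) (θ q)
  ≤⇒restrict⊆ p q p≤q = proj₂ (to (hom-≤ p q) p≤q)

  dom-∘⇒dom-⨾ : ∀ p q u → dom (θ (p ∘ q)) u → dom (θ p ⨾ θ q) u
  dom-∘⇒dom-⨾ p q u (v , h) = v , to (hom-∘ p q u v) h

  dom-⨾⇒dom-∘ : ∀ p q u → dom (θ p ⨾ θ q) u → dom (θ (p ∘ q)) u
  dom-⨾⇒dom-∘ p q u (v , h) = v , from (hom-∘ p q u v) h

  restrict-∘ : ∀ {y} {Y : X → Set y} p q p′ q′ →
               RestrictSubset (θ p ⨾ θ q) Y (θ p′ ⨾ θ q′) →
               RestrictSubset (θ (p ∘ q)) Y (θ (p′ ∘ q′))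
  restrict-∘ p q p′ q′ ⨾⊆⨾ u v Yu h =
    from (hom-∘ p′ q′ u v) (⨾⊆⨾ u v Yu (to (hom-∘ p q u v) h))

  ◀ₙ⇒dom⊆ : ∀ n p q → (◀ n) p q → ∀ u → dom (θ p) u → dom (θ q) u
  ◁ₙ⇒restrict⊆ : ∀ n s p q → (◁ n) s p q → RestrictSubset (θ p) (dom (θ s)) (θ q)

  ◀ₙ⇒dom⊆ zero p q (inj₁ (Level.lift q≤p)) = ≤⇒dom⊇ q p q≤p
  ◀ₙ⇒dom⊆ zero p q (inj₂ (c , q∘c≤p)) u dom-p =
    dom-⨾ˡ (θ q) (θ c) u (dom-∘⇒dom-⨾ q c u (≤⇒dom⊇ (q ∘ c) p q∘c≤p u dom-p))
  ◀ₙ⇒dom⊆ (suc n) p q (inj₁ p◁q) u (v , θpuv) =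
    v , ◁ₙ⇒restrict⊆ n p p q p◁q u v (v , θpuv) θpuv
  ◀ₙ⇒dom⊆ (suc n) p q (inj₂ (inj₁ (c , p◀c , c◀q))) u dom-p =
    ◀ₙ⇒dom⊆ n c q c◀q u (◀ₙ⇒dom⊆ n p c p◀c u dom-p)
  ◀ₙ⇒dom⊆ (suc n) _ _ (inj₂ (inj₂ (d , f , f′ , refl , f◀f′ , refl))) u dom-d∘f =
    dom-⨾⇒dom-∘ d f′ u
      (dom-⨾-monoʳ (θ d) (θ f) (θ f′) (◀ₙ⇒dom⊆ n f f′ f◀f′) u (dom-∘⇒dom-⨾ d f u dom-d∘f))

  ◁ₙ⇒restrict⊆ zero _ p q (Level.lift p≤q , refl) = ≤⇒restrict⊆ p q p≤q
  ◁ₙ⇒restrict⊆ (suc n) s p q (inj₁ (c , p◁c , c◁q)) =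
    restrict-trans (θ p) (θ c) (θ q) (◁ₙ⇒restrict⊆ n s p c p◁c) (◁ₙ⇒restrict⊆ n s c q c◁q)
  ◁ₙ⇒restrict⊆ (suc n) s _ _ (inj₂ (inj₁ (c , c′ , d , d′ , refl , c◁c′ , d◁d′ , refl))) =
    restrict-∘ c d c′ d′
      (restrict-⨾ (θ c) (θ c′) (θ d) (θ d′) (◁ₙ⇒restrict⊆ n s c c′ c◁c′) (◁ₙ⇒restrict⊆ n d d d′ d◁d′))
  ◁ₙ⇒restrict⊆ (suc n) s p q (inj₂ (inj₂ (s′ , p◁q , s◀s′))) =
    restrict-antitone (θ p) (θ q) (◀ₙ⇒dom⊆ n s s′ s◀s′) (◁ₙ⇒restrict⊆ n s′ p q p◁q)

lemma2 : ∀ {a ℓ x r : Level} (𝒮 : LCStructure a ℓ) {X : Set x}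
    (ρ : Representation 𝒮 X r) →
    let open LCStructure 𝒮
        open Representation ρ
        open Triangles 𝒮
    in (∀ p q → p ◀ q → ∀ u → dom (θ p) u → dom (θ q) u)
    × (∀ p q s → p ◁[ s ] q → RestrictSubset (θ p) (dom (θ s)) (θ q))
lemma2 𝒮 ρ =
    (λ p q (n , p◀q) → ◀ₙ⇒dom⊆ n p q p◀q)
  , (λ p q s (n , p◁q) → ◁ₙ⇒restrict⊆ n s p q p◁q)
  where open Soundness 𝒮 ρ
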